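{- Let $G$ be a graph, $X\subseteq V(G)$ a vertex cut-set, and $G_1,G_2$ induced subgraphs of $G$ with $V(G_1)\cup V(G_2)=V(G)$ and $V(G_1)\cap V(G_2)=X$. Let $f,g,h\in\mathbb{N}^{V(G)}$ with $h\le g\le f$. Define $f',g'\in\mathbb{N}^{V(G)}$ by $f'(v)=f(v)-\sum_{u\in N_G[v]\cap X}h(u)$ for $v\in V(G_2)$ and $f'(v)=f(v)$ for $v\notin V(G_2)$; and $g'(v)=g(v)-h(v)$ for $v\in X$, $g'(v)=g(v)$ for $v\notin X$. If $(f,h)_X\preceq(f,g)_{G_1}$ and $G_2$ is $(f',g')$-DP-colorable (with $f',g'$ restricted to $V(G_2)$), then $G$ is $(f,g)$-DP-colorable.
   Context: Cover, $f$-cover, quasi-independent set: a cover of $G$ is $(L,H)$ with $\{L(u)\}$ a partition of $V(H)$, $H$-edges between $L(u)$ and $L(v)$ only if $v\in N_G[u]$, each $H[L(u)]$ complete, and for $uv\in E(G)$ the $H$-edges between $L(u),L(v)$ forming a matching; an $f$-cover has $|L(v)|=f(v)$. Cross-edges are $H$-edges between distinct parts; $S\subseteq V(H)$ is quasi-independent if it spans no cross-edge. For $g\in\mathbb{N}^{V(G)}$ and a cover $\mathcal{H}$, an $(\mathcal{H},g)$-coloring of $G$ is a quasi-independent $S$ with $|S\cap L(v)|=g(v)$ for all $v$; equivalently a map $\phi$ with $\phi(v)\subseteq L(v)$, $|\phi(v)|=g(v)$, and $\bigcup_v\phi(v)$ quasi-independent. $G$ is $(f,g)$-DP-colorable if it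 has an $(\mathcal{H},g)$-coloring for every $f$-cover $\mathcal{H}$. Functions on $V(G)$ are compared pointwise. An $f$-cover of $G$ is regarded as a cover of any induced subgraph $G[X]$ by restriction. For $h\le h'\le f$ and an $(\mathcal{H},h)$-coloring $\phi$ of $G[X]$, an $h'$-augmentation of $\phi$ is an $(\mathcal{H},h')$-coloring $\phi'$ of $G[X]$ with $\phi(v)\subseteq\phi'(v)$ for all $v\in X$. An $(\mathcal{H},g)$-coloring $\psi$ of $G[X]$ is $(\mathcal{H},g)$-extendable if some $(\mathcal{H},g)$-coloring of $G$ agrees with $\psi$ on $X$. For $h\le g\le f$, an $(\mathcal{H},h)$-coloring $\phi$ of $G[X]$ is strongly $(\mathcal{H},g)$-extendable if $\phi$ has a $g$-augmentation and every $g$-augmentation of $\phi$ is $(\mathcal{H},g)$-extendable. The notation $(f,h)_X\preceq(f,g)_G$ (for $X\subseteq V(G)$, $h\le g\le f$) means: for every $f$-cover $\mathcal{H}$ of $G$ there is a strongly $(\mathcal{H},g)$-extendable $(\mathcal{H},h)$-coloring of $G[X]$. Only the values of $h$ on $X$ matter. -}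

module Defs where

open import Data.Bool using (Bool; true; false; T; _∧_; _∨_; if_then_else_)
open import Data.Nat using (ℕ; zero; suc; _+_; _∸_; _≤_)
open import Data.Fin using (Fin)
import Data.Fin as Fin
open import Data.Fin.Subset using (Subset; _∈_; _⊆_; ∣_∣)
open import Data.Product using (Σ; Σ-syntax; _×_; _,_; proj₁)
open import Data.Sum using (_⊎_)
open import Data.Unit using (tt)
open import Relation.Nullary using (¬_)
open import Relation.Nullary.Decidable using (⌊_⌋)
open import Relation.Binary.PropositionalEquality using (_≡_; _≢_)

record Graph (V : Set) : Set where
  field
    adj    : V → V → Bool
    sym    : ∀ u v → adj u v ≡ adj v u
    irrefl : ∀ v → adj v v ≡ false
open Graph public

Sub : {V : Set} → (V → Bool) → Set
Sub {V} Y = Σ V (λ v → T (Y v))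

induced : {V : Set} → Graph V → (Y : V → Bool) → Graph (Sub Y)
induced G Y = record
  { adj    = λ u v → adj G (proj₁ u) (proj₁ v)
  ; sym    = λ u v → sym G (proj₁ u) (proj₁ v)
  ; irrefl = λ v → irrefl G (proj₁ v) }

-- f-covers.  V(H) = Σ v, Fin (f v), the part L(v) being {v} × Fin (f v)
-- (so |L(v)| = f v).  H u i v j is adjacency of (u,i) and (v,j) in H.

record Cover {V : Set} (G : Graph V) (f : V → ℕ) : Set where
  field
    H         : (u : V) → Fin (f u) → (v : V) → Fin (f v) → Bool
    H-sym     : ∀ u i v j → H u i v j ≡ H v j u i
    H-irrefl  : ∀ u i → H u i u i ≡ false
    H-local   : ∀ u i v j → H u i v j ≡ true → (u ≡ v ⊎ adj G u v ≡ true)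
    H-clique  : ∀ u i j → i ≢ j → H u i u j ≡ true
    -- for uv ∈ E(G), the H-edges between L(u) and L(v) form a matching
    -- (by symmetry of H this covers both sides)
    H-match   : ∀ u v → adj G u v ≡ true →
                ∀ i j j′ → H u i v j ≡ true → H u i v j′ ≡ true → j ≡ j′
open Cover public

ColMap : {V : Set} → (f : V → ℕ) → (X : V → Bool) → Set
ColMap {V} f X = (v : V) → T (X v) → Subset (f v)

QuasiIndep : {V : Set} {G : Graph V} {f : V → ℕ} → Cover G f →
             (X : V → Bool) → ColMap f X → Set
QuasiIndep {V} C X φ =
  ∀ (u : V) (pu : T (X u)) i (v : V) (pv : T (X v)) j → u ≢ v →
  i ∈ φ u pu → j ∈ φ v pv → H C u i v j ≡ false

IsColoringOn : {V : Set} {G : Graph V} {f : V → ℕ} → Cover G f →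
               (X : V → Bool) → (g : V → ℕ) → ColMap f X → Set
IsColoringOn {V} C X g φ =
  ((v : V) (p : T (X v)) → ∣ φ v p ∣ ≡ g v) × QuasiIndep C X φ

ColoringOn : {V : Set} {G : Graph V} {f : V → ℕ} → Cover G f →
             (X : V → Bool) → (g : V → ℕ) → Set
ColoringOn {f = f} C X g = Σ (ColMap f X) (IsColoringOn C X g)

all : {V : Set} → V → Bool
all _ = true

Coloring : {V : Set} {G : Graph V} {f : V → ℕ} → Cover G f → (g : V → ℕ) → Set
Coloring C g = ColoringOn C all g

DPColorable : {V : Set} → Graph V → (f g : V → ℕ) → Set
DPColorable G f g = ∀ (C : Cover G f) → Coloring C g

IsAugmentation : {V : Set} {G : Graph V} {f : V → ℕ} (C : Cover G f)
                 (X : V → Bool) {h h′ : V → ℕ} →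
                 ColoringOn C X h → ColoringOn C X h′ → Set
IsAugmentation C X (φ , _) (ψ , _) = ∀ v p → φ v p ⊆ ψ v p

Extendable : {V : Set} {G : Graph V} {f : V → ℕ} (C : Cover G f)
             (X : V → Bool) (g : V → ℕ) → ColoringOn C X g → Set
Extendable C X g (ψ , _) =
  Σ[ χ ∈ Coloring C g ] (∀ v (p : T (X v)) → proj₁ χ v tt ≡ ψ v p)

StronglyExtendable : {V : Set} {G : Graph V} {f : V → ℕ} (C : Cover G f)
                     (X : V → Bool) {h : V → ℕ} (g : V → ℕ) →
                     ColoringOn C X h → Set
StronglyExtendable C X g φ =
  (Σ[ ψ ∈ ColoringOn C X g ] IsAugmentation C X φ ψ) ×
  (∀ (ψ : ColoringOn C X g) → IsAugmentation C X φ ψ → Extendable C X g ψ)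

Preceq : {V : Set} (G : Graph V) (X : V → Bool) (f h g : V → ℕ) → Set
Preceq G X f h g =
  ∀ (C : Cover G f) → Σ[ φ ∈ ColoringOn C X h ] StronglyExtendable C X g φ

sumFin : (n : ℕ) → (Fin n → ℕ) → ℕ
sumFin zero    a = 0
sumFin (suc n) a = a Fin.zero + sumFin n (λ i → a (Fin.suc i))

closedNbr : {n : ℕ} → Graph (Fin n) → Fin n → Fin n → Bool
closedNbr G v u = ⌊ u Fin.≟ v ⌋ ∨ adj G v u

nbrSum : {n : ℕ} → Graph (Fin n) → (X : Fin n → Bool) → (h : Fin n → ℕ) → Fin n → ℕ
nbrSum {n} G X h v = sumFin n (λ u → if closedNbr G v u ∧ X u then h u else 0)

f′ : {n : ℕ} → Graph (Fin n) → (V₂ X : Fin n → Bool) → (f h : Fin n → ℕ) → Fin n → ℕ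
f′ G V₂ X f h v = if V₂ v then f v ∸ nbrSum G X h v else f v

g′ : {n : ℕ} → (X : Fin n → Bool) → (g h : Fin n → ℕ) → Fin n → ℕ
g′ X g h v = if X v then g v ∸ h v else g v

_≤ᶠ_ : {V : Set} → (V → ℕ) → (V → ℕ) → Set
a ≤ᶠ b = ∀ v → a v ≤ b v

{-# OPTIONS --safe #-}
-- Restricting the cover to G₁ gives a strongly extendable h-colouring φ of X. A vertex v of
-- G₂ loses to φ at most Σ_{u ∈ N[v] ∩ X} h(u) colours of L(v): the colours of φ(v), and for
-- each neighbour u ∈ X the partners of φ(u), of which there are at most h(u) because the
-- cross edges between L(u) and L(v) form a matching. The remaining colours contain an
-- f′-cover of G₂, and a g′-colouring ψ of G₂ in it has no cross edge to φ. On X, φ ∪ ψ is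
-- then a g-augmentation of φ, so it extends to a g-colouring χ of G₁; as X separates
-- V(G₁) from V(G₂) ∖ X, χ together with ψ on V(G₂) ∖ V(G₁) is a g-colouring of G.
module Submission where

open import Defs renaming (sym to adj-sym)
open import Data.Bool using (Bool; true; false; T; not; _∧_; _∨_; if_then_else_)
import Data.Bool as Bool
open import Data.Bool.Properties using (T-irrelevant; T?; T-∧; T-∨; T-≡; ∨-zeroʳ; if-cong)
open import Data.Fin using (Fin; zero; suc; _≟_)
open import Data.Fin.Properties using (suc-injective; inject≤-injective; injective⇒≤; any?)
import Data.Fin as Fin
open import Data.Fin.Subset using (Subset; inside; outside; _∈_; _∉_; _⊆_; ∣_∣; ⊥; ∁; _∪_)
open import Data.Fin.Subset.Properties
  using (_∈?_; ∉⊥; x∈∁p⇒x∉p; x∈p∪q⁻; p⊆p∪q; q⊆p∪q; ∪-identityˡ; ∪-identityʳ; ∣⊥∣≡0; ∣∁p∣≡n∸∣p∣)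
open import Data.Nat using (ℕ; zero; suc; _+_; _∸_; _≤_; z≤n; s≤s)
open import Data.Nat.Properties
  using (≤-trans; ≤-reflexive; ≤-antisym; +-suc; +-mono-≤; +-monoʳ-≤; n≤1+n; ∸-monoʳ-≤; m+[n∸m]≡n;
         module ≤-Reasoning)
open import Data.Product using (Σ; Σ-syntax; ∃; _×_; _,_; proj₁; proj₂)
open import Data.Sum using (inj₁; inj₂; [_,_]′; map₁)
open import Data.Unit using (tt)
open import Data.Vec using ([]; _∷_; tabulate; here; there)
open import Function using (_∘_; case_of_; Injective)
open import Function.Bundles using (Equivalence)
open import Level using (Level)
open import Relation.Nullary using (¬_; yes; no; does; contradiction)
open import Relation.Nullary.Decidable using (_×-dec_; toSum)
open import Relation.Unary using (Pred; Decidable)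
open import Relation.Binary.PropositionalEquality
  using (_≡_; _≢_; refl; sym; trans; cong; cong₂; subst; module ≡-Reasoning)

private variable
  ℓ : Level
  m k : ℕ
  V : Set

¬T⇒≡false : {b : Bool} → ¬ T b → b ≡ false
¬T⇒≡false {false} _  = refl
¬T⇒≡false {true}  ¬t = contradiction tt ¬t

¬T⇒T-not : {b : Bool} → ¬ T b → T (not b)
¬T⇒T-not {false} _  = tt
¬T⇒T-not {true}  ¬t = ¬t tt

T-not⇒¬T : {b : Bool} → T (not b) → ¬ T b
T-not⇒¬T {false} _ ()

-- Finite subsets

⟦_⟧ : {P : Pred (Fin m) ℓ} → Decidable P → Subset m
⟦ P? ⟧ = tabulate (does ∘ P?)

∈⟦⟧⁺ : {P : Pred (Fin m) ℓ} (P? : Decidable P) {i : Fin m} → P i → i ∈ ⟦ P? ⟧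
∈⟦⟧⁺ P? {zero} Pi with P? zero
... | yes _  = here
... | no ¬Pi = contradiction Pi ¬Pi
∈⟦⟧⁺ P? {suc i} Pi = there (∈⟦⟧⁺ (P? ∘ suc) Pi)

∈⟦⟧⁻ : {P : Pred (Fin m) ℓ} (P? : Decidable P) {i : Fin m} → i ∈ ⟦ P? ⟧ → P i
∈⟦⟧⁻ P? {zero} i∈ with P? zero | i∈
... | yes Pi | _ = Pi
... | no _   | ()
∈⟦⟧⁻ P? {suc i} (there i∈) = ∈⟦⟧⁻ (P? ∘ suc) i∈

members : (p : Subset m) → Fin ∣ p ∣ → Fin m
members (outside ∷ p) a       = suc (members p a)
members (inside  ∷ p) zero    = zero
members (inside  ∷ p) (suc a) = suc (members p a)

members-∈ : (p : Subset m) (a : Fin ∣ p ∣) → members p a ∈ p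
members-∈ (outside ∷ p) a       = there (members-∈ p a)
members-∈ (inside  ∷ p) zero    = here
members-∈ (inside  ∷ p) (suc a) = there (members-∈ p a)

members-injective : (p : Subset m) → Injective _≡_ _≡_ (members p)
members-injective (outside ∷ p)                 e = members-injective p (suc-injective e)
members-injective (inside  ∷ p) {zero}  {zero}  e = refl
members-injective (inside  ∷ p) {suc a} {suc b} e =
  cong suc (members-injective p (suc-injective e))

rank : {p : Subset m} {i : Fin m} → i ∈ p → Fin ∣ p ∣
rank {p = inside  ∷ p} here        = zero
rank {p = inside  ∷ p} (there i∈p) = suc (rank i∈p)
rank {p = outside ∷ p} (there i∈p) = rank i∈p

rank-injective : {p : Subset m} {i j : Fin m} (i∈p : i ∈ p) (j∈p : j ∈ p) →
                 rank i∈p ≡ rank j∈p → i ≡ j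
rank-injective {p = inside  ∷ p} here        here        _ = refl
rank-injective {p = inside  ∷ p} (there i∈p) (there j∈p) e =
  cong suc (rank-injective i∈p j∈p (suc-injective e))
rank-injective {p = outside ∷ p} (there i∈p) (there j∈p) e =
  cong suc (rank-injective i∈p j∈p e)

injection⇒∣p∣≤∣q∣ : {p : Subset m} {q : Subset k}
                    (F : ∀ {i} → i ∈ p → Fin k) → (∀ {i} (i∈p : i ∈ p) → F i∈p ∈ q) →
                    (∀ {i j} (i∈p : i ∈ p) (j∈p : j ∈ p) → F i∈p ≡ F j∈p → i ≡ j) →
                    ∣ p ∣ ≤ ∣ q ∣
injection⇒∣p∣≤∣q∣ {p = p} F F∈q F-inj = injective⇒≤ λ e →
  members-injective p (F-inj _ _ (rank-injective (F∈q (members-∈ p _)) (F∈q (members-∈ p _)) e))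

choose : (p : Subset m) → k ≤ ∣ p ∣ → Fin k → Fin m
choose p k≤∣p∣ a = members p (Fin.inject≤ a k≤∣p∣)

choose-∈ : (p : Subset m) (k≤∣p∣ : k ≤ ∣ p ∣) (a : Fin k) → choose p k≤∣p∣ a ∈ p
choose-∈ p k≤∣p∣ a = members-∈ p (Fin.inject≤ a k≤∣p∣)

choose-injective : (p : Subset m) (k≤∣p∣ : k ≤ ∣ p ∣) → Injective _≡_ _≡_ (choose p k≤∣p∣)
choose-injective p k≤∣p∣ e = inject≤-injective k≤∣p∣ k≤∣p∣ _ _ (members-injective p e)

∣p∪q∣≤∣p∣+∣q∣ : (p q : Subset m) → ∣ p ∪ q ∣ ≤ ∣ p ∣ + ∣ q ∣
∣p∪q∣≤∣p∣+∣q∣ []            []            = z≤n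
∣p∪q∣≤∣p∣+∣q∣ (outside ∷ p) (outside ∷ q) = ∣p∪q∣≤∣p∣+∣q∣ p q
∣p∪q∣≤∣p∣+∣q∣ (inside  ∷ p) (outside ∷ q) = s≤s (∣p∪q∣≤∣p∣+∣q∣ p q)
∣p∪q∣≤∣p∣+∣q∣ (outside ∷ p) (inside  ∷ q) =
  ≤-trans (s≤s (∣p∪q∣≤∣p∣+∣q∣ p q)) (≤-reflexive (sym (+-suc ∣ p ∣ ∣ q ∣)))
∣p∪q∣≤∣p∣+∣q∣ (inside  ∷ p) (inside  ∷ q) =
  s≤s (≤-trans (∣p∪q∣≤∣p∣+∣q∣ p q) (+-monoʳ-≤ ∣ p ∣ (n≤1+n ∣ q ∣)))

∣p∪q∣≡∣p∣+∣q∣ : (p q : Subset m) → (∀ {i} → i ∈ p → i ∉ q) → ∣ p ∪ q ∣ ≡ ∣ p ∣ + ∣ q ∣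
∣p∪q∣≡∣p∣+∣q∣ []            []            _ = refl
∣p∪q∣≡∣p∣+∣q∣ (outside ∷ p) (outside ∷ q) d =
  ∣p∪q∣≡∣p∣+∣q∣ p q (λ i∈p i∈q → d (there i∈p) (there i∈q))
∣p∪q∣≡∣p∣+∣q∣ (inside  ∷ p) (outside ∷ q) d =
  cong suc (∣p∪q∣≡∣p∣+∣q∣ p q (λ i∈p i∈q → d (there i∈p) (there i∈q)))
∣p∪q∣≡∣p∣+∣q∣ (outside ∷ p) (inside  ∷ q) d =
  trans (cong suc (∣p∪q∣≡∣p∣+∣q∣ p q (λ i∈p i∈q → d (there i∈p) (there i∈q))))
        (sym (+-suc ∣ p ∣ ∣ q ∣))
∣p∪q∣≡∣p∣+∣q∣ (inside  ∷ p) (inside  ∷ q) d = contradiction here (d here)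

⋃ᶠ : {n : ℕ} → (Fin n → Subset m) → Subset m
⋃ᶠ {n = zero}  B = ⊥
⋃ᶠ {n = suc n} B = B zero ∪ ⋃ᶠ (B ∘ suc)

∈⋃ᶠ : {n : ℕ} (B : Fin n → Subset m) (u : Fin n) {i : Fin m} → i ∈ B u → i ∈ ⋃ᶠ B
∈⋃ᶠ B zero    i∈ = p⊆p∪q _ i∈
∈⋃ᶠ B (suc u) i∈ = q⊆p∪q (B zero) _ (∈⋃ᶠ (B ∘ suc) u i∈)

∣⋃ᶠ∣≤sumFin : {n : ℕ} (B : Fin n → Subset m) → ∣ ⋃ᶠ B ∣ ≤ sumFin n (∣_∣ ∘ B)
∣⋃ᶠ∣≤sumFin {m} {zero} B = ≤-reflexive (∣⊥∣≡0 m)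
∣⋃ᶠ∣≤sumFin {m} {suc n} B = ≤-trans (∣p∪q∣≤∣p∣+∣q∣ (B zero) (⋃ᶠ (B ∘ suc)))
                                    (+-monoʳ-≤ ∣ B zero ∣ (∣⋃ᶠ∣≤sumFin (B ∘ suc)))

sumFin-mono-≤ : (n : ℕ) {a b : Fin n → ℕ} → (∀ u → a u ≤ b u) → sumFin n a ≤ sumFin n b
sumFin-mono-≤ zero    a≤b = z≤n
sumFin-mono-≤ (suc n) a≤b = +-mono-≤ (a≤b zero) (sumFin-mono-≤ n (a≤b ∘ suc))

hasPreimage? : (e : Fin k → Fin m) (p : Subset k) → Decidable (λ j → ∃ λ a → a ∈ p × e a ≡ j)
hasPreimage? e p j = any? (λ a → a ∈? p ×-dec e a ≟ j)

image : (Fin k → Fin m) → Subset k → Subset m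
image e p = ⟦ hasPreimage? e p ⟧

∈image⁺ : (e : Fin k → Fin m) (p : Subset k) {a : Fin k} → a ∈ p → e a ∈ image e p
∈image⁺ e p a∈p = ∈⟦⟧⁺ (hasPreimage? e p) (_ , a∈p , refl)

∈image⁻ : (e : Fin k → Fin m) (p : Subset k) {j : Fin m} → j ∈ image e p →
          ∃ λ a → a ∈ p × e a ≡ j
∈image⁻ e p = ∈⟦⟧⁻ (hasPreimage? e p)

∣image∣ : (e : Fin k → Fin m) → Injective _≡_ _≡_ e → (p : Subset k) → ∣ image e p ∣ ≡ ∣ p ∣
∣image∣ e e-inj p = ≤-antisym
  (injection⇒∣p∣≤∣q∣ (proj₁ ∘ ∈image⁻ e p) (proj₁ ∘ proj₂ ∘ ∈image⁻ e p) preimage-injective)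
  (injection⇒∣p∣≤∣q∣ (λ {a} _ → e a) (∈image⁺ e p) (λ _ _ → e-inj))
  where
  preimage-injective : ∀ {i j} (i∈ : i ∈ image e p) (j∈ : j ∈ image e p) →
                       proj₁ (∈image⁻ e p i∈) ≡ proj₁ (∈image⁻ e p j∈) → i ≡ j
  preimage-injective i∈ j∈ a≡b with ∈image⁻ e p i∈ | ∈image⁻ e p j∈
  ... | _ , _ , refl | _ , _ , refl = cong e a≡b

module _ {k : V → ℕ} (Y : V → Bool) (κ : (v : Sub Y) → Subset (k (proj₁ v))) where

  extend⊥ : (v : V) → Subset (k v)
  extend⊥ v with T? (Y v)
  ... | yes y = κ (v , y)
  ... | no _  = ⊥

  extend⊥-in : ∀ {v} (y : T (Y v)) → extend⊥ v ≡ κ (v , y)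
  extend⊥-in {v} y with T? (Y v)
  ... | yes y′ = cong (λ y → κ (v , y)) (T-irrelevant y′ y)
  ... | no ¬y  = contradiction y ¬y

  extend⊥-out : ∀ {v} → ¬ T (Y v) → extend⊥ v ≡ ⊥
  extend⊥-out {v} ¬y with T? (Y v)
  ... | yes y = contradiction y ¬y
  ... | no _  = refl

  ∈extend⊥⁻ : ∀ {v i} → i ∈ extend⊥ v → Σ (T (Y v)) λ y → i ∈ κ (v , y)
  ∈extend⊥⁻ {v} i∈ with T? (Y v)
  ... | yes y = y , i∈
  ... | no _  = contradiction i∈ ∉⊥

-- Graphs and covers

Sub-≡ : {Y : V → Bool} {u v : Sub Y} → proj₁ u ≡ proj₁ v → u ≡ v
Sub-≡ {u = u , p} {.u , q} refl = cong (u ,_) (T-irrelevant p q)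

closedNbr-≢ : {n : ℕ} (G : Graph (Fin n)) {u v : Fin n} → u ≢ v →
              closedNbr G v u ≡ true → adj G u v ≡ true
closedNbr-≢ G {u} {v} u≢v v~u with u ≟ v
... | yes u≡v = contradiction u≡v u≢v
... | no _    = trans (adj-sym G u v) v~u

adj⇒closedNbr : {n : ℕ} (G : Graph (Fin n)) {u v : Fin n} →
                adj G u v ≡ true → closedNbr G v u ≡ true
adj⇒closedNbr G {u} {v} u~v rewrite adj-sym G v u | u~v = ∨-zeroʳ _

closedNbr-refl : {n : ℕ} (G : Graph (Fin n)) (v : Fin n) → closedNbr G v v ≡ true
closedNbr-refl G v with v ≟ v
... | yes _   = refl
... | no v≢v = contradiction refl v≢v

restrict : {G : Graph V} {f : V → ℕ} → Cover G f → (Y : V → Bool) →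
           Cover (induced G Y) (f ∘ proj₁)
restrict C Y = record
  { H        = λ u i v j → H C (proj₁ u) i (proj₁ v) j
  ; H-sym    = λ u i v j → H-sym C (proj₁ u) i (proj₁ v) j
  ; H-irrefl = λ u i → H-irrefl C (proj₁ u) i
  ; H-local  = λ u i v j e → map₁ Sub-≡ (H-local C (proj₁ u) i (proj₁ v) j e)
  ; H-clique = λ u → H-clique C (proj₁ u)
  ; H-match  = λ u v → H-match C (proj₁ u) (proj₁ v)
  }

reindex : {G : Graph V} {f k : V → ℕ} → Cover G f →
          (e : ∀ v → Fin (k v) → Fin (f v)) → (∀ v → Injective _≡_ _≡_ (e v)) → Cover G k
reindex C e e-inj = record
  { H        = λ u i v j → H C u (e u i) v (e v j)
  ; H-sym    = λ u i v j → H-sym C u (e u i) v (e v j)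
  ; H-irrefl = λ u i → H-irrefl C u (e u i)
  ; H-local  = λ u i v j → H-local C u (e u i) v (e v j)
  ; H-clique = λ u i j i≢j → H-clique C u (e u i) (e u j) (i≢j ∘ e-inj u)
  ; H-match  = λ u v u~v i j j′ e₁ e₂ → e-inj v (H-match C u v u~v (e u i) (e v j) (e v j′) e₁ e₂)
  }

H-nonadjacent : {G : Graph V} {f : V → ℕ} (C : Cover G f)
                {u v : V} {i : Fin (f u)} {j : Fin (f v)} →
                u ≢ v → adj G u v ≡ false → H C u i v j ≡ false
H-nonadjacent C {u} {v} {i} {j} u≢v u≁v with H C u i v j in e
... | false = refl
... | true with H-local C u i v j e
...   | inj₁ u≡v = contradiction u≡v u≢v
...   | inj₂ u~v = contradiction (trans (sym u~v) u≁v) λ ()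

module _ {G : Graph V} {f : V → ℕ} (C : Cover G f) where

  hasCrossNbr? : (u v : V) (S : Subset (f u)) → Decidable (λ j → ∃ λ i → i ∈ S × H C u i v j ≡ true)
  hasCrossNbr? u v S j = any? (λ i → i ∈? S ×-dec H C u i v j Bool.≟ true)

  crossNbrs : (u v : V) → Subset (f u) → Subset (f v)
  crossNbrs u v S = ⟦ hasCrossNbr? u v S ⟧

  ∈crossNbrs⁺ : ∀ {u v} (S : Subset (f u)) {i j} → i ∈ S → H C u i v j ≡ true → j ∈ crossNbrs u v S
  ∈crossNbrs⁺ {u} {v} S i∈S uivj = ∈⟦⟧⁺ (hasCrossNbr? u v S) (_ , i∈S , uivj)

  ∣crossNbrs∣≤ : ∀ {u v} → adj G u v ≡ true → (S : Subset (f u)) → ∣ crossNbrs u v S ∣ ≤ ∣ S ∣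
  ∣crossNbrs∣≤ {u} {v} u~v S = injection⇒∣p∣≤∣q∣ (proj₁ ∘ nbr) (proj₁ ∘ proj₂ ∘ nbr) matched
    where
    nbr : ∀ {j} → j ∈ crossNbrs u v S → ∃ λ i → i ∈ S × H C u i v j ≡ true
    nbr = ∈⟦⟧⁻ (hasCrossNbr? u v S)
    matched : ∀ {j j′} (j∈ : j ∈ crossNbrs u v S) (j′∈ : j′ ∈ crossNbrs u v S) →
              proj₁ (nbr j∈) ≡ proj₁ (nbr j′∈) → j ≡ j′
    matched j∈ j′∈ i≡i′ with nbr j∈ | nbr j′∈
    ... | i , _ , uivj | _ , _ , uivj′ rewrite i≡i′ = H-match C u v u~v _ _ _ uivj uivj′

  NoCrossEdges : ((v : V) → Subset (f v)) → ((v : V) → Subset (f v)) → Set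
  NoCrossEdges α β = ∀ {u v} {i : Fin (f u)} {j : Fin (f v)} →
                     u ≢ v → i ∈ α u → j ∈ β v → H C u i v j ≡ false

  NoCrossEdges-sym : ∀ {α β} → NoCrossEdges α β → NoCrossEdges β α
  NoCrossEdges-sym α⊥β u≢v i∈ j∈ = trans (H-sym C _ _ _ _) (α⊥β (u≢v ∘ sym) j∈ i∈)

  NoCrossEdges-∪ : ∀ {α β} → NoCrossEdges α α → NoCrossEdges α β → NoCrossEdges β β →
                   NoCrossEdges (λ v → α v ∪ β v) (λ v → α v ∪ β v)
  NoCrossEdges-∪ {α} {β} α⊥α α⊥β β⊥β {u} {v} u≢v i∈ j∈
    with x∈p∪q⁻ (α u) (β u) i∈ | x∈p∪q⁻ (α v) (β v) j∈
  ... | inj₁ i∈α | inj₁ j∈α = α⊥α u≢v i∈α j∈α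
  ... | inj₁ i∈α | inj₂ j∈β = α⊥β u≢v i∈α j∈β
  ... | inj₂ i∈β | inj₁ j∈α = NoCrossEdges-sym α⊥β u≢v i∈β j∈α
  ... | inj₂ i∈β | inj₂ j∈β = β⊥β u≢v i∈β j∈β

  extend⊥-noCross : (Y : V → Bool) (κ : ColMap (f ∘ proj₁) all) → QuasiIndep (restrict C Y) all κ →
                   NoCrossEdges (extend⊥ Y (λ v → κ v tt)) (extend⊥ Y (λ v → κ v tt))
  extend⊥-noCross Y κ κ-indep u≢v i∈ j∈ with ∈extend⊥⁻ Y _ i∈ | ∈extend⊥⁻ Y _ j∈
  ... | yu , i∈κ | yv , j∈κ = κ-indep (_ , yu) tt _ (_ , yv) tt _ (u≢v ∘ cong proj₁) i∈κ j∈κ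

  image-indep : {k : V → ℕ} (e : ∀ v → Fin (k v) → Fin (f v))
                (e-inj : ∀ v → Injective _≡_ _≡_ (e v))
                (κ : ColMap k all) → QuasiIndep (reindex C e e-inj) all κ →
                QuasiIndep C all (λ v _ → image (e v) (κ v tt))
  image-indep e e-inj κ κ-indep u _ i v _ j u≢v i∈ j∈
    with ∈image⁻ (e u) (κ u tt) i∈ | ∈image⁻ (e v) (κ v tt) j∈
  ... | a , a∈κ , refl | b , b∈κ , refl = κ-indep u tt a v tt b u≢v a∈κ b∈κ

-- Gluing colourings along the cut X

module Gluing {n : ℕ} (G : Graph (Fin n)) (X V₁ V₂ : Fin n → Bool)
  (V₁∪V₂ : ∀ v → V₁ v ∨ V₂ v ≡ true)
  (V₁∩V₂ : ∀ v → V₁ v ∧ V₂ v ≡ X v)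
  (separated : ∀ u v → V₁ u ≡ true → X u ≡ false → V₂ v ≡ true → X v ≡ false →
               adj G u v ≡ false)
  (f g h : Fin n → ℕ) (h≤g : h ≤ᶠ g)
  (X⪯G₁ : Preceq (induced G V₁) (X ∘ proj₁) (f ∘ proj₁) (h ∘ proj₁) (g ∘ proj₁))
  (G₂-colorable : DPColorable (induced G V₂) (f′ G V₂ X f h ∘ proj₁) (g′ X g h ∘ proj₁))
  (C : Cover G f)
  where

  X⇒V₁ : ∀ {v} → T (X v) → T (V₁ v)
  X⇒V₁ {v} x = proj₁ (Equivalence.to T-∧ (subst T (sym (V₁∩V₂ v)) x))

  X⇒V₂ : ∀ {v} → T (X v) → T (V₂ v)
  X⇒V₂ {v} x = proj₂ (Equivalence.to T-∧ (subst T (sym (V₁∩V₂ v)) x))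

  ¬V₁⇒V₂ : ∀ {v} → ¬ T (V₁ v) → T (V₂ v)
  ¬V₁⇒V₂ {v} ¬v₁ with Equivalence.to T-∨ (Equivalence.from T-≡ (V₁∪V₂ v))
  ... | inj₁ v₁ = contradiction v₁ ¬v₁
  ... | inj₂ v₂ = v₂

  V₁∖X≁V₂∖V₁ : ∀ {u v} → T (V₁ u) → ¬ T (X u) → ¬ T (V₁ v) → adj G u v ≡ false
  V₁∖X≁V₂∖V₁ {u} {v} u₁ ¬xu ¬v₁ =
    separated u v (Equivalence.to T-≡ u₁) (¬T⇒≡false ¬xu)
                  (Equivalence.to T-≡ (¬V₁⇒V₂ ¬v₁)) (¬T⇒≡false (¬v₁ ∘ X⇒V₁))

  C₁ : Cover (induced G V₁) (f ∘ proj₁)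
  C₁ = restrict C V₁

  φ : ColoringOn C₁ (X ∘ proj₁) (h ∘ proj₁)
  φ = proj₁ (X⪯G₁ C₁)

  φ̂ : (v : Fin n) → Subset (f v)
  φ̂ = extend⊥ X (λ (v , x) → proj₁ φ (v , X⇒V₁ x) x)

  φ≡φ̂ : ∀ {v} (v₁ : T (V₁ v)) (x : T (X v)) → proj₁ φ (v , v₁) x ≡ φ̂ v
  φ≡φ̂ {v} v₁ x = trans (cong (λ v₁ → proj₁ φ (v , v₁) x) (T-irrelevant v₁ (X⇒V₁ x)))
                       (sym (extend⊥-in X _ x))

  ∣φ̂∣ : ∀ {v} → T (X v) → ∣ φ̂ v ∣ ≡ h v
  ∣φ̂∣ {v} x = trans (cong ∣_∣ (sym (φ≡φ̂ (X⇒V₁ x) x))) (proj₁ (proj₂ φ) (v , X⇒V₁ x) x)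

  φ̂-noCross : NoCrossEdges C φ̂ φ̂
  φ̂-noCross u≢v i∈ j∈ with ∈extend⊥⁻ X _ i∈ | ∈extend⊥⁻ X _ j∈
  ... | xu , i∈φ | xv , j∈φ =
    proj₂ (proj₂ φ) (_ , X⇒V₁ xu) xu _ (_ , X⇒V₁ xv) xv _ (u≢v ∘ cong proj₁) i∈φ j∈φ

  blockedBy : (v u : Fin n) → Subset (f v)
  blockedBy v u with u ≟ v
  ... | yes refl = φ̂ v
  ... | no _     = crossNbrs C u v (φ̂ u)

  blockedAt : (v u : Fin n) → Subset (f v)
  blockedAt v u = if closedNbr G v u ∧ X u then blockedBy v u else ⊥

  blocked : (v : Fin n) → Subset (f v)
  blocked v = ⋃ᶠ (blockedAt v)

  ∣blockedBy∣≤ : ∀ {v u} → T (closedNbr G v u ∧ X u) → ∣ blockedBy v u ∣ ≤ h u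
  ∣blockedBy∣≤ {v} {u} t with Equivalence.to T-∧ t | u ≟ v
  ... | _ , x   | yes refl = ≤-reflexive (∣φ̂∣ x)
  ... | v~u , x | no u≢v   =
    ≤-trans (∣crossNbrs∣≤ C (closedNbr-≢ G u≢v (Equivalence.to T-≡ v~u)) (φ̂ u))
            (≤-reflexive (∣φ̂∣ x))

  ∣blocked∣≤nbrSum : ∀ v → ∣ blocked v ∣ ≤ nbrSum G X h v
  ∣blocked∣≤nbrSum v = ≤-trans (∣⋃ᶠ∣≤sumFin (blockedAt v)) (sumFin-mono-≤ n bound)
    where
    bound : ∀ u → ∣ blockedAt v u ∣ ≤ (if closedNbr G v u ∧ X u then h u else 0)
    bound u with closedNbr G v u ∧ X u in c
    ... | true  = ∣blockedBy∣≤ (Equivalence.from T-≡ c)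
    ... | false = ≤-reflexive (∣⊥∣≡0 (f v))

  blockedBy⊆blocked : ∀ {v u} → closedNbr G v u ≡ true → T (X u) → blockedBy v u ⊆ blocked v
  blockedBy⊆blocked {v} {u} v~u x i∈ =
    ∈⋃ᶠ (blockedAt v) u (subst (_ ∈_) (sym (if-cong (cong₂ _∧_ v~u (Equivalence.to T-≡ x)))) i∈)

  φ̂⊆blocked : ∀ {v} → φ̂ v ⊆ blocked v
  φ̂⊆blocked {v} i∈ =
    blockedBy⊆blocked (closedNbr-refl G v) (proj₁ (∈extend⊥⁻ X _ i∈)) (blockedBy-self i∈)
    where
    blockedBy-self : φ̂ v ⊆ blockedBy v v
    blockedBy-self i∈ with v ≟ v
    ... | yes refl = i∈
    ... | no v≢v   = contradiction refl v≢v

  crossNbr∈blocked : ∀ {u v i j} → u ≢ v → i ∈ φ̂ u → H C u i v j ≡ true → j ∈ blocked v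
  crossNbr∈blocked {u} {v} {i} {j} u≢v i∈ uivj with H-local C u i v j uivj
  ... | inj₁ u≡v = contradiction u≡v u≢v
  ... | inj₂ u~v =
    blockedBy⊆blocked (adj⇒closedNbr G u~v) (proj₁ (∈extend⊥⁻ X _ i∈)) blockedBy-cross
    where
    blockedBy-cross : j ∈ blockedBy v u
    blockedBy-cross with u ≟ v
    ... | yes u≡v = contradiction u≡v u≢v
    ... | no _    = ∈crossNbrs⁺ C (φ̂ u) i∈ uivj

  f′≤∣unblocked∣ : ∀ {v} → T (V₂ v) → f′ G V₂ X f h v ≤ ∣ ∁ (blocked v) ∣
  f′≤∣unblocked∣ {v} v₂ = begin
    f′ G V₂ X f h v          ≡⟨ if-cong (Equivalence.to T-≡ v₂) ⟩
    f v ∸ nbrSum G X h v     ≤⟨ ∸-monoʳ-≤ (f v) (∣blocked∣≤nbrSum v) ⟩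
    f v ∸ ∣ blocked v ∣      ≡⟨ sym (∣∁p∣≡n∸∣p∣ (blocked v)) ⟩
    ∣ ∁ (blocked v) ∣        ∎
    where open ≤-Reasoning

  palette : (v : Sub V₂) → Fin (f′ G V₂ X f h (proj₁ v)) → Fin (f (proj₁ v))
  palette (v , v₂) = choose (∁ (blocked v)) (f′≤∣unblocked∣ v₂)

  palette-injective : ∀ v → Injective _≡_ _≡_ (palette v)
  palette-injective (v , v₂) = choose-injective (∁ (blocked v)) (f′≤∣unblocked∣ v₂)

  ψ : Coloring (reindex (restrict C V₂) palette palette-injective) (g′ X g h ∘ proj₁)
  ψ = G₂-colorable (reindex (restrict C V₂) palette palette-injective)

  ψ̂ : (v : Fin n) → Subset (f v)
  ψ̂ = extend⊥ V₂ (λ v → image (palette v) (proj₁ ψ v tt))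

  ∣ψ̂∣ : ∀ {v} → T (V₂ v) → ∣ ψ̂ v ∣ ≡ g′ X g h v
  ∣ψ̂∣ {v} v₂ = begin
    ∣ ψ̂ v ∣                                            ≡⟨ cong ∣_∣ (extend⊥-in V₂ _ v₂) ⟩
    ∣ image (palette (v , v₂)) (proj₁ ψ (v , v₂) tt) ∣ ≡⟨ ∣image∣ _ (palette-injective (v , v₂)) _ ⟩
    ∣ proj₁ ψ (v , v₂) tt ∣                            ≡⟨ proj₁ (proj₂ ψ) (v , v₂) tt ⟩
    g′ X g h v                                         ∎
    where open ≡-Reasoning

  ψ̂-unblocked : ∀ {v i} → i ∈ ψ̂ v → i ∉ blocked v
  ψ̂-unblocked {v} i∈ =
    let v₂ , i∈image = ∈extend⊥⁻ V₂ _ i∈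
        a , _ , a↦i  = ∈image⁻ (palette (v , v₂)) _ i∈image
    in subst (_∉ blocked v) a↦i (x∈∁p⇒x∉p (choose-∈ (∁ (blocked v)) (f′≤∣unblocked∣ v₂) a))

  ψ̂-noCross : NoCrossEdges C ψ̂ ψ̂
  ψ̂-noCross = extend⊥-noCross C V₂ _
    (image-indep (restrict C V₂) palette palette-injective _ (proj₂ (proj₂ ψ)))

  φ̂-ψ̂-noCross : NoCrossEdges C φ̂ ψ̂
  φ̂-ψ̂-noCross {u} {v} {i} {j} u≢v i∈ j∈ with H C u i v j in uivj
  ... | false = refl
  ... | true  = contradiction (crossNbr∈blocked u≢v i∈ uivj) (ψ̂-unblocked j∈)

  ∣φ̂∪ψ̂∣ : ∀ {v} → T (X v) → ∣ φ̂ v ∪ ψ̂ v ∣ ≡ g v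
  ∣φ̂∪ψ̂∣ {v} x = begin
    ∣ φ̂ v ∪ ψ̂ v ∣        ≡⟨ ∣p∪q∣≡∣p∣+∣q∣ (φ̂ v) (ψ̂ v) disjoint ⟩
    ∣ φ̂ v ∣ + ∣ ψ̂ v ∣    ≡⟨ cong₂ _+_ (∣φ̂∣ x) (∣ψ̂∣ (X⇒V₂ x)) ⟩
    h v + g′ X g h v      ≡⟨ cong (h v +_) (if-cong (Equivalence.to T-≡ x)) ⟩
    h v + (g v ∸ h v)     ≡⟨ m+[n∸m]≡n (h≤g v) ⟩
    g v                   ∎
    where
    open ≡-Reasoning
    disjoint : ∀ {i} → i ∈ φ̂ v → i ∉ ψ̂ v
    disjoint i∈φ̂ i∈ψ̂ = ψ̂-unblocked i∈ψ̂ (φ̂⊆blocked i∈φ̂)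

  θ : ColoringOn C₁ (X ∘ proj₁) (g ∘ proj₁)
  θ = (λ v _ → φ̂ (proj₁ v) ∪ ψ̂ (proj₁ v))
    , (λ _ x → ∣φ̂∪ψ̂∣ x)
    , (λ _ _ _ _ _ _ u≢v → NoCrossEdges-∪ C φ̂-noCross φ̂-ψ̂-noCross ψ̂-noCross (u≢v ∘ Sub-≡))

  θ-augments-φ : IsAugmentation C₁ (X ∘ proj₁) φ θ
  θ-augments-φ (v , v₁) x i∈ = p⊆p∪q (ψ̂ v) (subst (_ ∈_) (φ≡φ̂ v₁ x) i∈)

  χ-extends-θ : Extendable C₁ (X ∘ proj₁) (g ∘ proj₁) θ
  χ-extends-θ = proj₂ (proj₂ (X⪯G₁ C₁)) θ θ-augments-φ

  χ : Coloring C₁ (g ∘ proj₁)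
  χ = proj₁ χ-extends-θ

  χ̂ : (v : Fin n) → Subset (f v)
  χ̂ = extend⊥ V₁ (λ v → proj₁ χ v tt)

  χ̂≡φ̂∪ψ̂ : ∀ {v} → T (X v) → χ̂ v ≡ φ̂ v ∪ ψ̂ v
  χ̂≡φ̂∪ψ̂ x = trans (extend⊥-in V₁ _ (X⇒V₁ x)) (proj₂ χ-extends-θ (_ , X⇒V₁ x) x)

  ψ̂∖V₁ : (v : Fin n) → Subset (f v)
  ψ̂∖V₁ = extend⊥ (not ∘ V₁) (ψ̂ ∘ proj₁)

  ψ̂∖V₁-noCross : NoCrossEdges C ψ̂∖V₁ ψ̂∖V₁
  ψ̂∖V₁-noCross u≢v i∈ j∈ =
    ψ̂-noCross u≢v (proj₂ (∈extend⊥⁻ (not ∘ V₁) _ i∈)) (proj₂ (∈extend⊥⁻ (not ∘ V₁) _ j∈))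

  χ̂-ψ̂-noCross : ∀ {u v} {i : Fin (f u)} {j : Fin (f v)} → u ≢ v → ¬ T (V₁ v) →
                 i ∈ χ̂ u → j ∈ ψ̂ v → H C u i v j ≡ false
  χ̂-ψ̂-noCross {u} {v} {i} {j} u≢v ¬v₁ i∈ j∈ = case T? (X u) of λ where
    (yes x) → NoCrossEdges-∪ C φ̂-noCross φ̂-ψ̂-noCross ψ̂-noCross u≢v
                (subst (i ∈_) (χ̂≡φ̂∪ψ̂ x) i∈) (q⊆p∪q (φ̂ v) (ψ̂ v) j∈)
    (no ¬x) → H-nonadjacent C u≢v (V₁∖X≁V₂∖V₁ (proj₁ (∈extend⊥⁻ V₁ _ i∈)) ¬x ¬v₁)

  χ̂-ψ̂∖V₁-noCross : NoCrossEdges C χ̂ ψ̂∖V₁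
  χ̂-ψ̂∖V₁-noCross u≢v i∈ j∈ =
    χ̂-ψ̂-noCross u≢v (T-not⇒¬T (proj₁ j∈ψ̂)) i∈ (proj₂ j∈ψ̂)
    where j∈ψ̂ = ∈extend⊥⁻ (not ∘ V₁) _ j∈

  ∣χ̂∪ψ̂∖V₁∣-on-V₁ : ∀ {v} → T (V₁ v) → ∣ χ̂ v ∪ ψ̂∖V₁ v ∣ ≡ g v
  ∣χ̂∪ψ̂∖V₁∣-on-V₁ {v} v₁ = begin
    ∣ χ̂ v ∪ ψ̂∖V₁ v ∣
      ≡⟨ cong (λ s → ∣ χ̂ v ∪ s ∣) (extend⊥-out (not ∘ V₁) _ (λ t → T-not⇒¬T t v₁)) ⟩
    ∣ χ̂ v ∪ ⊥ ∣
      ≡⟨ cong ∣_∣ (∪-identityʳ (χ̂ v)) ⟩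
    ∣ χ̂ v ∣
      ≡⟨ cong ∣_∣ (extend⊥-in V₁ _ v₁) ⟩
    ∣ proj₁ χ (v , v₁) tt ∣
      ≡⟨ proj₁ (proj₂ χ) (v , v₁) tt ⟩
    g v ∎
    where open ≡-Reasoning

  ∣χ̂∪ψ̂∖V₁∣-off-V₁ : ∀ {v} → ¬ T (V₁ v) → ∣ χ̂ v ∪ ψ̂∖V₁ v ∣ ≡ g v
  ∣χ̂∪ψ̂∖V₁∣-off-V₁ {v} ¬v₁ = begin
    ∣ χ̂ v ∪ ψ̂∖V₁ v ∣  ≡⟨ cong (λ s → ∣ s ∪ ψ̂∖V₁ v ∣) (extend⊥-out V₁ _ ¬v₁) ⟩
    ∣ ⊥ ∪ ψ̂∖V₁ v ∣    ≡⟨ cong ∣_∣ (∪-identityˡ (ψ̂∖V₁ v)) ⟩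
    ∣ ψ̂∖V₁ v ∣        ≡⟨ cong ∣_∣ (extend⊥-in (not ∘ V₁) _ (¬T⇒T-not ¬v₁)) ⟩
    ∣ ψ̂ v ∣           ≡⟨ ∣ψ̂∣ (¬V₁⇒V₂ ¬v₁) ⟩
    g′ X g h v        ≡⟨ if-cong (¬T⇒≡false (¬v₁ ∘ X⇒V₁)) ⟩
    g v               ∎
    where open ≡-Reasoning

  ∣χ̂∪ψ̂∖V₁∣ : ∀ v → ∣ χ̂ v ∪ ψ̂∖V₁ v ∣ ≡ g v
  ∣χ̂∪ψ̂∖V₁∣ v = [ ∣χ̂∪ψ̂∖V₁∣-on-V₁ , ∣χ̂∪ψ̂∖V₁∣-off-V₁ ]′ (toSum (T? (V₁ v)))

  coloring : Coloring C g
  coloring = (λ v _ → χ̂ v ∪ ψ̂∖V₁ v)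
           , (λ v _ → ∣χ̂∪ψ̂∖V₁∣ v)
           , (λ _ _ _ _ _ _ → NoCrossEdges-∪ C (extend⊥-noCross C V₁ _ (proj₂ (proj₂ χ)))
                                               χ̂-ψ̂∖V₁-noCross ψ̂∖V₁-noCross)

mainTheorem3 :
    (n : ℕ) (G : Graph (Fin n)) (X V₁ V₂ : Fin n → Bool) →
    -- V(G₁) ∪ V(G₂) = V(G) and V(G₁) ∩ V(G₂) = X
    (∀ v → V₁ v ∨ V₂ v ≡ true) →
    (∀ v → V₁ v ∧ V₂ v ≡ X v) →
    -- X is a vertex cut-set separating V(G₁) ∖ X from V(G₂) ∖ X
    (∀ u v → V₁ u ≡ true → X u ≡ false → V₂ v ≡ true → X v ≡ false →
      adj G u v ≡ false) →
    (Σ[ u ∈ Fin n ] (V₁ u ≡ true × X u ≡ false)) →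
    (Σ[ v ∈ Fin n ] (V₂ v ≡ true × X v ≡ false)) →
    (f g h : Fin n → ℕ) → h ≤ᶠ g → g ≤ᶠ f →
    -- (f,h)_X ⪯ (f,g)_{G₁}
    Preceq (induced G V₁) (X ∘ proj₁) (f ∘ proj₁) (h ∘ proj₁) (g ∘ proj₁) →
    -- G₂ is (f′,g′)-DP-colorable
    DPColorable (induced G V₂) (f′ G V₂ X f h ∘ proj₁) (g′ X g h ∘ proj₁) →
    DPColorable G f g
mainTheorem3 n G X V₁ V₂ V₁∪V₂ V₁∩V₂ separated _ _ f g h h≤g _ X⪯G₁ G₂-colorable C =
  Gluing.coloring G X V₁ V₂ V₁∪V₂ V₁∩V₂ separated f g h h≤g X⪯G₁ G₂-colorable C
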